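{- Let $G$ be a flow-admissible signed graph, let $v\in V(G)$ be a vertex of degree at least 4, and let $e,e'\in\delta(v)$. Let $G'$ be the signed graph obtained from $G$ by uncontracting at $v$ with $e,e'$, and let $f$ be the newly added (uncontracted) edge. Then at least one of $G'$ or $G'-f$ is flow-admissible.
   Context: Graphs are finite and may have parallel edges and loops; $\delta(v)$ is the multiset of edges incident to $v$ (a loop counted twice) and $d(v)=|\delta(v)|$. A signed graph is a graph with a signature $\Sigma\subseteq E(G)$ of negative edges; other edges are positive. An orientation assigns, for each vertex $v$, a bipartition of $\delta(v)$ into $\delta^+(v)$ (directed away from $v$) and $\delta^-(v)$ (directed toward $v$) so that $\Delta_{v}\delta^+(v)$ (symmetric difference) is exactly the set of positive edges. For $f:E(G)\to\mathbb{Z}$ the boundary is $\partial f(v)=\sum_{e\in\delta^+(v)}f(e)-\sum_{e\in\delta^-(v)}f(e)$; $f$ is a flow if $\partial f\equiv0$, nowhere-zero if it never takes value $0$. A signed graph is flow-admissible if it admits a nowhere-zero integer-valued flow under some orientation. Uncontracting: for $v$ with $d(v)\ge4$ and $e_1,e_2\in\delta(v)$ with other ends $v_1,v_2$ (loops allowed), to uncontract at $v$ with $e_1,e_2$ means to add a new vertex $v'$, change the ends of $e_1$ and $e_2$ to be $v',v_1$ and $v',v_2$ respectively (keeping their signs), and add a new positive edge with ends $v,v'$. -}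

module Defs where

open import Data.Nat using (ℕ; zero; suc)
open import Data.Fin using (Fin; zero; suc; _≟_)
open import Data.Bool using (Bool; true; false; if_then_else_; not; _xor_)
open import Data.Integer as ℤ using (ℤ)
open import Data.Product using (Σ; _×_; _,_)
open import Relation.Binary.PropositionalEquality using (_≡_; _≢_)
open import Relation.Nullary.Decidable using (⌊_⌋; _×-dec_; _⊎-dec_)

sumℕ : (k : ℕ) → (Fin k → ℕ) → ℕ
sumℕ zero    g = 0
sumℕ (suc k) g = g zero Data.Nat.+ sumℕ k (λ i → g (suc i))

sumℤ : (k : ℕ) → (Fin k → ℤ) → ℤ
sumℤ zero    g = ℤ.0ℤ
sumℤ (suc k) g = g zero ℤ.+ sumℤ k (λ i → g (suc i))

-- Each edge e has two ends (half-edges) indexed by Fin 2, attached to the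
-- vertices  end e zero  and  end e (suc zero)  (equal for a loop, so a loop
-- contributes two half-edges to δ(v)).  neg e = true iff e ∈ Σ.
record SignedGraph (n m : ℕ) : Set where
  field
    end : Fin m → Fin 2 → Fin n
    neg : Fin m → Bool
open SignedGraph public

deg : ∀ {n m} → SignedGraph n m → Fin n → ℕ
deg {n} {m} G v =
  sumℕ m (λ e → sumℕ 2 (λ i → if ⌊ end G e i ≟ v ⌋ then 1 else 0))

-- An orientation: for each half-edge (e , i) whether it lies in δ⁺ (true)
-- or δ⁻ (false) of its vertex.  Edge e lies in the symmetric difference
-- Δ_v δ⁺(v) iff an odd number of its half-edges are outgoing, i.e.
-- out e 0 xor out e 1; this must hold exactly for the positive edges.
Orientation : ∀ {n m} → SignedGraph n m → Set
Orientation {n} {m} G = Fin m → Fin 2 → Bool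

IsOrientation : ∀ {n m} → (G : SignedGraph n m) → Orientation G → Set
IsOrientation {n} {m} G out =
  ∀ e → (out e zero xor out e (suc zero)) ≡ not (neg G e)

boundary : ∀ {n m} → (G : SignedGraph n m) → Orientation G →
           (Fin m → ℤ) → Fin n → ℤ
boundary {n} {m} G out f v =
  sumℤ m (λ e → sumℤ 2 (λ i →
    if ⌊ end G e i ≟ v ⌋
      then (if out e i then f e else ℤ.- f e)
      else ℤ.0ℤ))

IsFlow : ∀ {n m} → (G : SignedGraph n m) → Orientation G → (Fin m → ℤ) → Set
IsFlow G out f = ∀ v → boundary G out f v ≡ ℤ.0ℤ

NowhereZero : ∀ {m} → (Fin m → ℤ) → Set
NowhereZero f = ∀ e → f e ≢ ℤ.0ℤ

FlowAdmissible : ∀ {n m} → SignedGraph n m → Set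
FlowAdmissible {n} {m} G =
  Σ (Orientation G) λ out → IsOrientation G out ×
  Σ (Fin m → ℤ) λ f → IsFlow G out f × NowhereZero f

-- Uncontracting at v with the half-edges (e₁ , i₁) and (e₂ , i₂) (ends of
-- e₁, e₂ at v).  New vertex v' = zero, old vertex w becomes suc w.
-- New edge f = zero (positive, ends v and v'), old edge e becomes suc e.
uncontract : ∀ {n m} → SignedGraph n m → Fin n →
             Fin m → Fin 2 → Fin m → Fin 2 → SignedGraph (suc n) (suc m)
end (uncontract G v e₁ i₁ e₂ i₂) zero zero = suc v
end (uncontract G v e₁ i₁ e₂ i₂) zero (suc zero) = zero
end (uncontract G v e₁ i₁ e₂ i₂) (suc e) i =
  if ⌊ (e ≟ e₁ ×-dec i ≟ i₁) ⊎-dec (e ≟ e₂ ×-dec i ≟ i₂) ⌋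
    then zero
    else suc (end G e i)
neg (uncontract G v e₁ i₁ e₂ i₂) zero = false
neg (uncontract G v e₁ i₁ e₂ i₂) (suc e) = neg G e

deleteFirstEdge : ∀ {n m} → SignedGraph n (suc m) → SignedGraph n m
end (deleteFirstEdge G) e i = end G (suc e) i
neg (deleteFirstEdge G) e = neg G (suc e)

-- Uncontracting v into v and a new vertex v' moves two half-edges of v to v'.
-- Under a nowhere-zero flow f of G these half-edges carry a net outflow M
-- from v' (and hence a net inflow M into v, since f is balanced at v).  If
-- M = 0, then f is already a flow of G' minus the new edge; otherwise the new
-- positive edge v → v' carrying M rebalances both ends and gives a flow of G'.
module Submission where

open import Defs
open import Data.Nat using (ℕ; zero; suc; _≤_)
open import Data.Fin using (Fin; zero; suc; _≟_)
open import Data.Bool using (Bool; true; false; if_then_else_)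
open import Data.Integer using (ℤ; 0ℤ; _+_; _-_; -_)
open import Data.Integer.Properties using (+-identityˡ; +-identityʳ)
import Data.Integer.Properties as ℤ
open import Data.Integer.Tactic.RingSolver using (solve-∀)
open import Data.Product using (_×_; _,_)
open import Data.Sum using (_⊎_; inj₁; inj₂)
open import Relation.Binary.PropositionalEquality
  using (_≡_; _≢_; refl; sym; trans; cong; cong₂; module ≡-Reasoning)
open import Relation.Nullary using (Dec; yes; no)
open import Relation.Nullary.Decidable using (⌊_⌋; _×-dec_; _⊎-dec_)
import Algebra.Properties.CommutativeSemigroup as CommSemigroupProperties

open CommSemigroupProperties ℤ.+-commutativeSemigroup using (interchange)

sumℤ-cong : ∀ k {g h : Fin k → ℤ} → (∀ i → g i ≡ h i) → sumℤ k g ≡ sumℤ k h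
sumℤ-cong zero    g≗h = refl
sumℤ-cong (suc k) g≗h = cong₂ _+_ (g≗h zero) (sumℤ-cong k (λ i → g≗h (suc i)))

sumℤ-distrib-+ : ∀ k (g h : Fin k → ℤ) →
                 sumℤ k (λ i → g i + h i) ≡ sumℤ k g + sumℤ k h
sumℤ-distrib-+ zero    g h = refl
sumℤ-distrib-+ (suc k) g h =
  trans (cong (g zero + h zero +_) (sumℤ-distrib-+ k (λ i → g (suc i)) (λ i → h (suc i))))
        (interchange (g zero) (h zero) (sumℤ k (λ i → g (suc i))) (sumℤ k (λ i → h (suc i))))

sumℤ-zero : ∀ k → sumℤ k (λ _ → 0ℤ) ≡ 0ℤ
sumℤ-zero zero    = refl
sumℤ-zero (suc k) = cong (0ℤ +_) (sumℤ-zero k)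

sumℤ-if : ∀ k (b : Bool) (g : Fin k → ℤ) →
          sumℤ k (λ i → if b then g i else 0ℤ) ≡ (if b then sumℤ k g else 0ℤ)
sumℤ-if k true  g = refl
sumℤ-if k false g = sumℤ-zero k

module _ (k l : ℕ) where

  sumℤ²-cong : {g h : Fin k → Fin l → ℤ} → (∀ i j → g i j ≡ h i j) →
               sumℤ k (λ i → sumℤ l (g i)) ≡ sumℤ k (λ i → sumℤ l (h i))
  sumℤ²-cong g≗h = sumℤ-cong k (λ i → sumℤ-cong l (g≗h i))

  sumℤ²-distrib-+ : (g h : Fin k → Fin l → ℤ) →
                    sumℤ k (λ i → sumℤ l (λ j → g i j + h i j))
                      ≡ sumℤ k (λ i → sumℤ l (g i)) + sumℤ k (λ i → sumℤ l (h i))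
  sumℤ²-distrib-+ g h =
    trans (sumℤ-cong k (λ i → sumℤ-distrib-+ l (g i) (h i)))
          (sumℤ-distrib-+ k (λ i → sumℤ l (g i)) (λ i → sumℤ l (h i)))

  sumℤ²-if : (b : Bool) (g : Fin k → Fin l → ℤ) →
             sumℤ k (λ i → sumℤ l (λ j → if b then g i j else 0ℤ))
               ≡ (if b then sumℤ k (λ i → sumℤ l (g i)) else 0ℤ)
  sumℤ²-if b g =
    trans (sumℤ-cong k (λ i → sumℤ-if l b (g i)))
          (sumℤ-if k b (λ i → sumℤ l (g i)))

-- boundary G out f u is definitionally the double sum of at (end G e i) u (±f e).
at : ∀ {k} → Fin k → Fin k → ℤ → ℤ
at a u x = if ⌊ a ≟ u ⌋ then x else 0ℤ

module _ {k} (a u : Fin k) where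

  at-0ℤ : at a u 0ℤ ≡ 0ℤ
  at-0ℤ with ⌊ a ≟ u ⌋
  ... | true  = refl
  ... | false = refl

  at-neg : ∀ x → at a u (- x) ≡ - at a u x
  at-neg x with ⌊ a ≟ u ⌋
  ... | true  = refl
  ... | false = refl

  at-suc : ∀ x → at (suc a) (suc u) x ≡ at a u x
  at-suc x with a ≟ u
  ... | yes _ = refl
  ... | no  _ = refl

flowAdmissible-addEdge : ∀ {n m} (H : SignedGraph n (suc m)) → neg H zero ≡ false →
  (out : Orientation (deleteFirstEdge H)) → IsOrientation (deleteFirstEdge H) out →
  (g : Fin m → ℤ) → NowhereZero g → (M : ℤ) → M ≢ 0ℤ →
  (∀ u → boundary (deleteFirstEdge H) out g u
           ≡ at (end H zero (suc zero)) u M - at (end H zero zero) u M) →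
  FlowAdmissible H
flowAdmissible-addEdge {n} {m} H pos out isOr g nz M M≢0 ∂g =
  out′ , isOr′ , g′ , flow′ , nz′
  where
  out′ : Orientation H
  out′ zero zero       = true
  out′ zero (suc zero) = false
  out′ (suc e)         = out e

  isOr′ : IsOrientation H out′
  isOr′ zero    rewrite pos = refl
  isOr′ (suc e) = isOr e

  g′ : Fin (suc m) → ℤ
  g′ zero    = M
  g′ (suc e) = g e

  nz′ : NowhereZero g′
  nz′ zero    = M≢0
  nz′ (suc e) = nz e

  flow′ : IsFlow H out′ g′
  flow′ u = begin
      at a u M + (at b u (- M) + 0ℤ) + boundary (deleteFirstEdge H) out g u
    ≡⟨ cong₂ (λ y z → at a u M + (y + 0ℤ) + z) (at-neg b u M) (∂g u) ⟩
      at a u M + (- at b u M + 0ℤ) + (at b u M - at a u M)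
    ≡⟨ cancel (at a u M) (at b u M) ⟩
      0ℤ
    ∎
    where
    open ≡-Reasoning
    a b : Fin n
    a = end H zero zero
    b = end H zero (suc zero)
    cancel : ∀ p q → p + (- q + 0ℤ) + (q - p) ≡ 0ℤ
    cancel = solve-∀

module Uncontraction {n m} (G : SignedGraph n m) (v : Fin n)
  (e₁ : Fin m) (i₁ : Fin 2) (e₂ : Fin m) (i₂ : Fin 2)
  (e₁-at-v : end G e₁ i₁ ≡ v) (e₂-at-v : end G e₂ i₂ ≡ v)
  (out : Orientation G) (f : Fin m → ℤ) where

  G′ : SignedGraph (suc n) m
  G′ = deleteFirstEdge (uncontract G v e₁ i₁ e₂ i₂)

  Moved : Fin m → Fin 2 → Set
  Moved e i = (e ≡ e₁ × i ≡ i₁) ⊎ (e ≡ e₂ × i ≡ i₂)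

  moved? : ∀ e i → Dec (Moved e i)
  moved? e i = (e ≟ e₁ ×-dec i ≟ i₁) ⊎-dec (e ≟ e₂ ×-dec i ≟ i₂)

  moved-at-v : ∀ e i → Moved e i → end G e i ≡ v
  moved-at-v e i (inj₁ (refl , refl)) = e₁-at-v
  moved-at-v e i (inj₂ (refl , refl)) = e₂-at-v

  halfFlow : Fin m → Fin 2 → ℤ
  halfFlow e i = if out e i then f e else - f e

  movedFlow : Fin m → Fin 2 → ℤ
  movedFlow e i = if ⌊ moved? e i ⌋ then halfFlow e i else 0ℤ

  detachedOutflow : ℤ
  detachedOutflow = sumℤ m (λ e → sumℤ 2 (movedFlow e))

  relocate : ∀ {A : Set} → Dec A → Fin n → Fin (suc n)
  relocate d a = if ⌊ d ⌋ then zero else suc a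

  at-relocate-zero : ∀ {A : Set} (d : Dec A) a x →
                     at (relocate d a) zero x ≡ (if ⌊ d ⌋ then x else 0ℤ)
  at-relocate-zero (yes _) a x = refl
  at-relocate-zero (no  _) a x = refl

  at-relocate-suc : ∀ {A : Set} (d : Dec A) a u x → (A → a ≡ v) →
                    at a u x ≡ at (relocate d a) (suc u) x + at v u (if ⌊ d ⌋ then x else 0ℤ)
  at-relocate-suc (yes p) a u x a≡v rewrite a≡v p = sym (+-identityˡ _)
  at-relocate-suc (no  _) a u x _ =
    trans (sym (+-identityʳ _)) (cong₂ _+_ (sym (at-suc a u x)) (sym (at-0ℤ v u)))

  boundary-new-vertex : boundary G′ out f zero ≡ detachedOutflow
  boundary-new-vertex = sumℤ²-cong m 2 (λ e i →
    at-relocate-zero (moved? e i) (end G e i) (halfFlow e i))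

  boundary-split : ∀ u → boundary G out f u
                   ≡ boundary G′ out f (suc u) + at v u detachedOutflow
  boundary-split u = begin
      boundary G out f u
    ≡⟨ sumℤ²-cong m 2 (λ e i → at-relocate-suc (moved? e i) (end G e i) u (halfFlow e i)
                                                 (moved-at-v e i)) ⟩
      sumℤ m (λ e → sumℤ 2 (λ i → at (end G′ e i) (suc u) (halfFlow e i) + at v u (movedFlow e i)))
    ≡⟨ sumℤ²-distrib-+ m 2 (λ e i → at (end G′ e i) (suc u) (halfFlow e i))
                           (λ e i → at v u (movedFlow e i)) ⟩
      boundary G′ out f (suc u) + sumℤ m (λ e → sumℤ 2 (λ i → at v u (movedFlow e i)))
    ≡⟨ cong (boundary G′ out f (suc u) +_) (sumℤ²-if m 2 ⌊ v ≟ u ⌋ movedFlow) ⟩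
      boundary G′ out f (suc u) + at v u detachedOutflow
    ∎
    where open ≡-Reasoning

  boundary-uncontract : IsFlow G out f → ∀ u →
    boundary G′ out f u ≡ at zero u detachedOutflow - at (suc v) u detachedOutflow
  boundary-uncontract flow zero = trans boundary-new-vertex (sym (+-identityʳ _))
  boundary-uncontract flow (suc u) = begin
      boundary G′ out f (suc u)
    ≡⟨ add-sub (boundary G′ out f (suc u)) (at v u M) ⟩
      boundary G′ out f (suc u) + at v u M - at v u M
    ≡⟨ cong₂ _-_ (trans (sym (boundary-split u)) (flow u)) (sym (at-suc v u M)) ⟩
      0ℤ - at (suc v) (suc u) M
    ∎
    where
    open ≡-Reasoning
    M : ℤ
    M = detachedOutflow
    add-sub : ∀ p q → p ≡ p + q - q
    add-sub = solve-∀

  uncontract-flowAdmissible : IsOrientation G out → IsFlow G out f → NowhereZero f →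
    FlowAdmissible (uncontract G v e₁ i₁ e₂ i₂) ⊎ FlowAdmissible G′
  uncontract-flowAdmissible isOr flow nz with detachedOutflow ℤ.≟ 0ℤ
  ... | yes M≡0 = inj₂ (out , isOr , f , flow′ , nz)
    where
    flow′ : IsFlow G′ out f
    flow′ u = begin
        boundary G′ out f u
      ≡⟨ boundary-uncontract flow u ⟩
        at zero u detachedOutflow - at (suc v) u detachedOutflow
      ≡⟨ cong (λ M → at zero u M - at (suc v) u M) M≡0 ⟩
        at zero u 0ℤ - at (suc v) u 0ℤ
      ≡⟨ cong₂ _-_ (at-0ℤ zero u) (at-0ℤ (suc v) u) ⟩
        0ℤ
      ∎
      where open ≡-Reasoning
  ... | no M≢0 = inj₁ (flowAdmissible-addEdge (uncontract G v e₁ i₁ e₂ i₂) refl out isOr f nz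
                         detachedOutflow M≢0 (boundary-uncontract flow))

lemma2p2 : ∀ {n m} (G : SignedGraph n m) (v : Fin n)
           (e₁ : Fin m) (i₁ : Fin 2) (e₂ : Fin m) (i₂ : Fin 2) →
           FlowAdmissible G →
           4 ≤ deg G v →
           end G e₁ i₁ ≡ v →
           end G e₂ i₂ ≡ v →
           e₁ ≢ e₂ →
           FlowAdmissible (uncontract G v e₁ i₁ e₂ i₂)
             ⊎ FlowAdmissible (deleteFirstEdge (uncontract G v e₁ i₁ e₂ i₂))
lemma2p2 G v e₁ i₁ e₂ i₂ (out , isOr , f , flow , nz) _ e₁-at-v e₂-at-v _ =
  Uncontraction.uncontract-flowAdmissible G v e₁ i₁ e₂ i₂ e₁-at-v e₂-at-v out f isOr flow nz
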